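{- Let $m,n$ be integers with $n \ge m \ge 3$. Then the Cartesian product of cycles $C_m \square C_n$ is distance magic if and only if either $n=2m$ with $m$ odd, or $n=m$ with $m \equiv 2 \pmod 4$.
   Context: A graph $\Gamma=(V,E)$ of order $N$ is distance magic if there is a bijection $\ell: V \to \{1,\ldots,N\}$ such that the sum of the labels of all neighbours of $v$ (the weight of $v$) is the same for all $v \in V$. $C_m \square C_n$ denotes the Cartesian product of the cycles $C_m$ and $C_n$, i.e. the Cayley graph of $\mathbb{Z}_m \times \mathbb{Z}_n$ with connection set $\{\pm(1,0),\pm(0,1)\}$. -}

module Defs where

open import Data.Nat using (ℕ; zero; suc; _+_; _*_; _∸_; _%_; _≟_; NonZero)
open import Data.Nat.Properties using ()
open import Data.Fin using (Fin; toℕ)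
open import Data.Fin.Properties using ()
open import Data.Product using (Σ; ∃; _×_; _,_; proj₁; proj₂)
open import Data.Sum using (_⊎_)
open import Data.List using (List; map; allFin; cartesianProduct)
open import Data.Nat.ListAction using (sum)
open import Relation.Nullary using (Dec; yes; no; ¬_)
open import Relation.Nullary.Decidable using (_⊎-dec_; _×-dec_)
open import Relation.Binary.PropositionalEquality using (_≡_)
open import Function.Definitions using (Bijective)

record FinGraph : Set₁ where
  field
    V       : Set
    order   : ℕ
    verts   : List V                  -- each vertex exactly once
    Adj     : V → V → Set
    adj?    : ∀ u v → Dec (Adj u v)

-- Vertices of C_m □ C_n: Z_m × Z_n, represented as Fin m × Fin n.
-- "y - x ≡ ±1 (mod k)" for x y ∈ Z_k.
DiffPM1 : (k : ℕ) → Fin k → Fin k → Set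
DiffPM1 k x y = ((toℕ y + k ∸ toℕ x) % suc (k ∸ 1) ≡ 1)
              ⊎ ((toℕ x + k ∸ toℕ y) % suc (k ∸ 1) ≡ 1)

diffPM1? : (k : ℕ) → (x y : Fin k) → Dec (DiffPM1 k x y)
diffPM1? k x y = ((toℕ y + k ∸ toℕ x) % suc (k ∸ 1) ≟ 1)
            ⊎-dec ((toℕ x + k ∸ toℕ y) % suc (k ∸ 1) ≟ 1)

CycleAdj : (m n : ℕ) → Fin m × Fin n → Fin m × Fin n → Set
CycleAdj m n (a , b) (c , d) = (DiffPM1 m a c × b ≡ d) ⊎ (a ≡ c × DiffPM1 n b d)

cycleAdj? : (m n : ℕ) → (u v : Fin m × Fin n) → Dec (CycleAdj m n u v)
cycleAdj? m n (a , b) (c , d) =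
  (diffPM1? m a c ×-dec (b Data.Fin.≟ d)) ⊎-dec ((a Data.Fin.≟ c) ×-dec diffPM1? n b d)

CmCn : ℕ → ℕ → FinGraph
CmCn m n = record
  { V     = Fin m × Fin n
  ; order = m * n
  ; verts = cartesianProduct (allFin m) (allFin n)
  ; Adj   = CycleAdj m n
  ; adj?  = cycleAdj? m n
  }

weight : (G : FinGraph) → (FinGraph.V G → ℕ) → FinGraph.V G → ℕ
weight G ℓ v = sum (map f (FinGraph.verts G))
  where
  f : FinGraph.V G → ℕ
  f u with FinGraph.adj? G v u
  ... | yes _ = ℓ u
  ... | no  _ = 0

-- G is distance magic: there is a bijection ℓ : V → {1,…,N}
-- (encoded as a bijection onto Fin N, label = toℕ + 1) with constant weight.
DistanceMagic : FinGraph → Set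
DistanceMagic G =
  Σ (FinGraph.V G → Fin (FinGraph.order G)) λ ℓ →
    Bijective _≡_ _≡_ ℓ ×
    Σ ℕ λ k → ∀ v → weight G (λ u → suc (toℕ (ℓ u))) v ≡ k

-- Lift a labelling to an array G on ℕ × ℕ with periods m and n.  The
-- weight condition at (i+1, j+1) says that diag(i, j) = G(i, j) + G(i+1, j+1)
-- satisfies diag(i, j+1) + diag(i+1, j) = w, hence diag(i+2, j) = diag(i, j+2).
-- If a translation τ preserves diag and moves G like an even diagonal step, then
-- G ∘ τ − G changes sign along diagonals, so G is an arithmetic progression along
-- every τ-orbit; being periodic it is constant there, and injectivity makes τ
-- trivial.  For τ = (0, 2m) this gives n ∣ 2m, so n = 2m or n = m; the
-- translations (0, m) and (m/2, m/2), and diag = w/2 when m = n is odd, rule out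
-- the remaining cases.  With H = mn/2, give (i, j) the label H + K(i, j) on even rows and
-- H − 1 − K(i, j) on odd rows, where K(i, j) = A(i − j mod m) + B(i + j mod m).
-- Horizontal and vertical neighbours have equal K-sums, so every weight is 4H + 2;
-- for n = 2m with m odd and for n = m ≡ 2 (mod 4) there are digit maps A, B
-- making the labelling onto, hence bijective.

module Submission where

open import Defs
open import Data.Nat using (ℕ; _≤_; _*_; _%_)
open import Data.Product using (_×_)
open import Data.Sum using (_⊎_)
open import Relation.Binary.PropositionalEquality using (_≡_)
open import Function.Bundles using (_⇔_)

open import Data.Nat
open import Data.Nat.Properties
open import Data.Nat.DivMod
open import Data.Nat.Divisibility using (_∣_; divides; n∣m*n; m∣m*n; ∣-refl; ∣⇒≤; m%n≡0⇒n∣m)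
open import Data.Nat.Tactic.RingSolver using (solve-∀)
open import Data.Nat.ListAction using (sum)
open import Data.Fin as Fin using (Fin; toℕ; fromℕ<)
open import Data.Fin.Properties
  using (toℕ-fromℕ<; toℕ-injective; toℕ<n; any?; punchOut-injective; injective⇒≤; remQuot-combine)
open import Data.List using (List; []; _∷_; map; allFin; cartesianProduct)
open import Data.List.Properties using (map-cong)
open import Data.List.Membership.Propositional using (_∈_)
open import Data.List.Membership.Propositional.Properties using (∈-allFin; ∈-cartesianProduct⁺)
import Data.List.Membership.DecPropositional as DecMembership
open import Data.List.Relation.Unary.Any using (here; there)
open import Data.List.Relation.Unary.All as All using (All; []; _∷_)
open import Data.List.Relation.Unary.AllPairs using ([]; _∷_)
open import Data.List.Relation.Unary.Unique.Propositional using (Unique)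
open import Data.List.Relation.Unary.Unique.Propositional.Properties using (allFin⁺; cartesianProduct⁺)
open import Data.Product using (∃; ∃₂; _,_; proj₁; proj₂)
open import Data.Product.Properties using (≡-dec)
open import Data.Sum as Sum using (inj₁; inj₂)
open import Data.Empty using (⊥-elim)
open import Relation.Nullary using (Dec; yes; no; ¬_; contradiction)
open import Relation.Binary.Definitions using (DecidableEquality)
open import Relation.Binary.PropositionalEquality
  using (refl; sym; trans; cong; cong₂; subst; subst₂; _≢_; module ≡-Reasoning)
open import Function using (_∘_)
open import Function.Bundles using (mk⇔; Equivalence)
open import Function.Definitions using (Injective; StrictlySurjective; Bijective)
open import Function.Consequences.Propositional using (strictlySurjective⇒surjective)
open import Algebra.Properties.CommutativeSemigroup +-commutativeSemigroup
  using (interchange; xy∙z≈xz∙y; xy∙z≈x∙zy; x∙yz≈y∙zx; x∙yz≈xz∙y; x∙yz≈y∙xz)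

open ≡-Reasoning

-- Arithmetic modulo n

m+kn≡o+ln⇒m%n≡o%n : ∀ m k o l n .{{_ : NonZero n}} → m + k * n ≡ o + l * n → m % n ≡ o % n
m+kn≡o+ln⇒m%n≡o%n m k o l n eq = begin
  m % n           ≡⟨ [m+kn]%n≡m%n m k n ⟨
  (m + k * n) % n ≡⟨ cong (_% n) eq ⟩
  (o + l * n) % n ≡⟨ [m+kn]%n≡m%n o l n ⟩
  o % n           ∎

[m%n+o]%n≡[m+o]%n : ∀ m o n .{{_ : NonZero n}} → (m % n + o) % n ≡ (m + o) % n
[m%n+o]%n≡[m+o]%n m o n = m+kn≡o+ln⇒m%n≡o%n _ (m / n) _ 0 n (begin
  m % n + o + m / n * n ≡⟨ xy∙z≈xz∙y (m % n) o _ ⟩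
  m % n + m / n * n + o ≡⟨ cong (_+ o) (m≡m%n+[m/n]*n m n) ⟨
  m + o                 ≡⟨ +-identityʳ (m + o) ⟨
  m + o + 0             ∎)

[m+o%n]%n≡[m+o]%n : ∀ m o n .{{_ : NonZero n}} → (m + o % n) % n ≡ (m + o) % n
[m+o%n]%n≡[m+o]%n m o n = begin
  (m + o % n) % n ≡⟨ cong (_% n) (+-comm m (o % n)) ⟩
  (o % n + m) % n ≡⟨ [m%n+o]%n≡[m+o]%n o m n ⟩
  (o + m) % n     ≡⟨ cong (_% n) (+-comm o m) ⟩
  (m + o) % n     ∎

[o+m]%n≡[o+p]%n⇒m%n≡p%n : ∀ o m p n .{{_ : NonZero n}} →
  (o + m) % n ≡ (o + p) % n → m % n ≡ p % n
[o+m]%n≡[o+p]%n⇒m%n≡p%n o m p n eq = begin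
  m % n                 ≡⟨ [m+kn]%n≡m%n m o n ⟨
  (m + o * n) % n       ≡⟨ cong (_% n) (complement m) ⟩
  (c + (o + m)) % n     ≡⟨ [m+o%n]%n≡[m+o]%n c (o + m) n ⟨
  (c + (o + m) % n) % n ≡⟨ cong (λ x → (c + x) % n) eq ⟩
  (c + (o + p) % n) % n ≡⟨ [m+o%n]%n≡[m+o]%n c (o + p) n ⟩
  (c + (o + p)) % n     ≡⟨ cong (_% n) (complement p) ⟨
  (p + o * n) % n       ≡⟨ [m+kn]%n≡m%n p o n ⟩
  p % n                 ∎
  where
  c : ℕ
  c = o * n ∸ o
  complement : ∀ x → x + o * n ≡ c + (o + x)
  complement x = begin
    x + o * n   ≡⟨ cong (x +_) (m∸n+n≡m (m≤m*n o n)) ⟨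
    x + (c + o) ≡⟨ x∙yz≈y∙zx x c o ⟩
    c + (o + x) ∎

%2-alternates : ∀ j → (j % 2 ≡ 0 × (j + 1) % 2 ≡ 1) ⊎ (j % 2 ≡ 1 × (j + 1) % 2 ≡ 0)
%2-alternates zero          = inj₁ (refl , refl)
%2-alternates (suc zero)    = inj₂ (refl , refl)
%2-alternates (suc (suc j)) = %2-alternates j

%2-dichotomy : ∀ m → m % 2 ≡ 0 ⊎ m % 2 ≡ 1
%2-dichotomy m = Sum.map proj₁ proj₁ (%2-alternates m)

even∧4∤⇒%4≡2 : ∀ m → m % 2 ≡ 0 → ¬ 4 ∣ m → m % 4 ≡ 2
even∧4∤⇒%4≡2 m m-even 4∤m = residue (m % 4) refl (m%n<n m 4)
  where
  even-residue : ∀ {ρ} → m % 4 ≡ ρ → 0 ≡ ρ % 2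
  even-residue m%4≡ρ =
    trans (sym m-even) (trans (sym (m∣n⇒o%n%m≡o%m 2 4 m (divides 2 refl))) (cong (_% 2) m%4≡ρ))
  residue : ∀ ρ → m % 4 ≡ ρ → ρ < 4 → m % 4 ≡ 2
  residue 0 m%4≡0 _ = contradiction (m%n≡0⇒n∣m m 4 m%4≡0) 4∤m
  residue 1 m%4≡1 _ = contradiction (even-residue m%4≡1) λ ()
  residue 2 m%4≡2 _ = m%4≡2
  residue 3 m%4≡3 _ = contradiction (even-residue m%4≡3) λ ()
  residue (suc (suc (suc (suc _)))) _ (s≤s (s≤s (s≤s (s≤s ()))))

∣2*⇒≡2*⊎≡ : ∀ {m n} → 0 < m → m ≤ n → n ∣ 2 * m → n ≡ 2 * m ⊎ n ≡ m
∣2*⇒≡2*⊎≡ {m} {n} 0<m m≤n (divides q 2m≡qn) with q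
... | 0 = contradiction 2m≡qn (>⇒≢ (*-monoʳ-< 2 0<m))
... | 1 = inj₁ (sym (trans 2m≡qn (+-identityʳ n)))
... | 2 = inj₂ (sym (*-cancelˡ-≡ m n 2 2m≡qn))
... | suc (suc (suc q′)) = contradiction 2m≡qn (<⇒≢ (≤-<-trans (*-monoʳ-≤ 2 m≤n) 2n<qn))
  where
  2n<qn : 2 * n < suc (suc (suc q′)) * n
  2n<qn = <-≤-trans (*-monoˡ-< n {{>-nonZero (<-≤-trans 0<m m≤n)}} (n<1+n 2))
                    (*-monoˡ-≤ n {3} {suc (suc (suc q′))} (s≤s (s≤s (s≤s z≤n))))

[o+c*[j%n]]%m≡[o+c*j]%m : ∀ o c j {m n} .{{_ : NonZero m}} .{{_ : NonZero n}} → m ∣ n →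
  (o + c * (j % n)) % m ≡ (o + c * j) % m
[o+c*[j%n]]%m≡[o+c*j]%m o c j {m} {n} (divides q n≡qm) =
  m+kn≡o+ln⇒m%n≡o%n _ (c * (j / n) * q) _ 0 m (begin
    o + c * (j % n) + c * (j / n) * q * m ≡⟨ expand o c (j % n) (j / n) q m ⟩
    o + c * (j % n + j / n * (q * m))     ≡⟨ cong (λ x → o + c * (j % n + j / n * x)) n≡qm ⟨
    o + c * (j % n + j / n * n)           ≡⟨ cong (λ x → o + c * x) (m≡m%n+[m/n]*n j n) ⟨
    o + c * j                             ≡⟨ +-identityʳ (o + c * j) ⟨
    o + c * j + 0                         ∎)
  where
  expand : ∀ o c x y q m → o + c * x + c * y * q * m ≡ o + c * (x + y * (q * m))
  expand = solve-∀

[o+2[x+er]]%m≡[o+2[x+fr]]%m : ∀ o x e f {r m} .{{_ : NonZero m}} → m ∣ 2 * r →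
  (o + 2 * (x + e * r)) % m ≡ (o + 2 * (x + f * r)) % m
[o+2[x+er]]%m≡[o+2[x+fr]]%m o x e f {r} {m} (divides q 2r≡qm) =
  m+kn≡o+ln⇒m%n≡o%n _ (f * q) _ (e * q) m (begin
    o + 2 * (x + e * r) + f * q * m   ≡⟨ cong (o + 2 * (x + e * r) +_) (*-assoc f q m) ⟩
    o + 2 * (x + e * r) + f * (q * m) ≡⟨ cong (λ y → o + 2 * (x + e * r) + f * y) 2r≡qm ⟨
    o + 2 * (x + e * r) + f * (2 * r) ≡⟨ exchange o x e f r ⟩
    o + 2 * (x + f * r) + e * (2 * r) ≡⟨ cong (λ y → o + 2 * (x + f * r) + e * y) 2r≡qm ⟩
    o + 2 * (x + f * r) + e * (q * m) ≡⟨ cong (o + 2 * (x + f * r) +_) (*-assoc e q m) ⟨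
    o + 2 * (x + f * r) + e * q * m   ∎)
  where
  exchange : ∀ o x e f r → o + 2 * (x + e * r) + f * (2 * r) ≡ o + 2 * (x + f * r) + e * (2 * r)
  exchange = solve-∀

parity-choice : ∀ {r} → r % 2 ≡ 1 → ∀ x p → p < 2 → ∃ λ e → e < 2 × (x + e * r) % 2 ≡ p
parity-choice {r} r-odd x p p<2 = choose p p<2 (%2-dichotomy x)
  where
  e≡0 : (x + 0 * r) % 2 ≡ x % 2
  e≡0 = cong (_% 2) (+-identityʳ x)
  e≡1 : (x + 1 * r) % 2 ≡ (x % 2 + 1) % 2
  e≡1 = begin
    (x + 1 * r) % 2       ≡⟨ cong (λ y → (x + y) % 2) (*-identityˡ r) ⟩
    (x + r) % 2           ≡⟨ %-distribˡ-+ x r 2 ⟩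
    (x % 2 + r % 2) % 2   ≡⟨ cong (λ y → (x % 2 + y) % 2) r-odd ⟩
    (x % 2 + 1) % 2       ∎
  choose : ∀ p → p < 2 → x % 2 ≡ 0 ⊎ x % 2 ≡ 1 → ∃ λ e → e < 2 × (x + e * r) % 2 ≡ p
  choose 0 _ (inj₁ x-even) = 0 , z<s  , trans e≡0 x-even
  choose 0 _ (inj₂ x-odd)  = 1 , ≤-refl , trans e≡1 (cong (λ b → (b + 1) % 2) x-odd)
  choose 1 _ (inj₁ x-even) = 1 , ≤-refl , trans e≡1 (cong (λ b → (b + 1) % 2) x-even)
  choose 1 _ (inj₂ x-odd)  = 0 , z<s  , trans e≡0 x-odd
  choose (suc (suc _)) (s≤s (s≤s ())) _

x+er<2r : ∀ {x r} e → x < r → e < 2 → x + e * r < 2 * r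
x+er<2r {x} {r} 0 x<r _ = subst (_< 2 * r) (sym (+-identityʳ x)) (<-≤-trans x<r (m≤m+n r (r + 0)))
x+er<2r {x} {r} 1 x<r _ = +-monoˡ-< (r + 0) x<r
x+er<2r (suc (suc _)) _ (s≤s (s≤s ()))

-- Rotations of Fin (suc k)

toℕ-mod : ∀ i n .{{_ : NonZero n}} → toℕ (i mod n) ≡ i % n
toℕ-mod i n = toℕ-fromℕ< (m%n<n i n)

mod-cong : ∀ i j n .{{_ : NonZero n}} → i % n ≡ j % n → i mod n ≡ j mod n
mod-cong i j n eq = toℕ-injective (trans (toℕ-mod i n) (trans eq (sym (toℕ-mod j n))))

rotate : ∀ {k} → ℕ → Fin (suc k) → Fin (suc k)
rotate {k} c x = (toℕ x + c) mod suc k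

module _ {k : ℕ} where

  toℕ-rotate : ∀ c (x : Fin (suc k)) → toℕ (rotate c x) ≡ (toℕ x + c) % suc k
  toℕ-rotate c x = toℕ-mod (toℕ x + c) (suc k)

  rotate-zero : ∀ (x : Fin (suc k)) → rotate 0 x ≡ x
  rotate-zero x = toℕ-injective (begin
    toℕ (rotate 0 x)      ≡⟨ toℕ-rotate 0 x ⟩
    (toℕ x + 0) % suc k   ≡⟨ cong (_% suc k) (+-identityʳ (toℕ x)) ⟩
    toℕ x % suc k         ≡⟨ m<n⇒m%n≡m (toℕ<n x) ⟩
    toℕ x                 ∎)

  rotate-rotate : ∀ c d (x : Fin (suc k)) → rotate d (rotate c x) ≡ rotate (c + d) x
  rotate-rotate c d x = toℕ-injective (begin
    toℕ (rotate d (rotate c x))         ≡⟨ toℕ-rotate d (rotate c x) ⟩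
    (toℕ (rotate c x) + d) % suc k      ≡⟨ cong (λ y → (y + d) % suc k) (toℕ-rotate c x) ⟩
    ((toℕ x + c) % suc k + d) % suc k   ≡⟨ [m%n+o]%n≡[m+o]%n (toℕ x + c) d (suc k) ⟩
    (toℕ x + c + d) % suc k             ≡⟨ cong (_% suc k) (+-assoc (toℕ x) c d) ⟩
    (toℕ x + (c + d)) % suc k           ≡⟨ toℕ-rotate (c + d) x ⟨
    toℕ (rotate (c + d) x)              ∎)

  rotate-inverse : ∀ c d (x : Fin (suc k)) → c + d ≡ suc k → rotate d (rotate c x) ≡ x
  rotate-inverse c d x c+d≡n = toℕ-injective (begin
    toℕ (rotate d (rotate c x)) ≡⟨ cong toℕ (rotate-rotate c d x) ⟩
    toℕ (rotate (c + d) x)      ≡⟨ toℕ-rotate (c + d) x ⟩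
    (toℕ x + (c + d)) % suc k   ≡⟨ cong (λ y → (toℕ x + y) % suc k) c+d≡n ⟩
    (toℕ x + suc k) % suc k     ≡⟨ [m+n]%n≡m%n (toℕ x) (suc k) ⟩
    toℕ x % suc k               ≡⟨ m<n⇒m%n≡m (toℕ<n x) ⟩
    toℕ x                       ∎)

  rotate-≡⇔ : ∀ c d (x : Fin (suc k)) → rotate c x ≡ rotate d x ⇔ c % suc k ≡ d % suc k
  rotate-≡⇔ c d x = mk⇔
    (λ eq → [o+m]%n≡[o+p]%n⇒m%n≡p%n (toℕ x) c d (suc k)
              (trans (sym (toℕ-rotate c x)) (trans (cong toℕ eq) (toℕ-rotate d x))))
    (λ eq → toℕ-injective (begin
      toℕ (rotate c x)            ≡⟨ toℕ-rotate c x ⟩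
      (toℕ x + c) % suc k         ≡⟨ [m+o%n]%n≡[m+o]%n (toℕ x) c (suc k) ⟨
      (toℕ x + c % suc k) % suc k ≡⟨ cong (λ y → (toℕ x + y) % suc k) eq ⟩
      (toℕ x + d % suc k) % suc k ≡⟨ [m+o%n]%n≡[m+o]%n (toℕ x) d (suc k) ⟩
      (toℕ x + d) % suc k         ≡⟨ toℕ-rotate d x ⟨
      toℕ (rotate d x)            ∎))

  rotate-≢ : ∀ {c d} (x : Fin (suc k)) → c < suc k → d < suc k → c ≢ d → rotate c x ≢ rotate d x
  rotate-≢ {c} {d} x c<n d<n c≢d eq = c≢d (begin
    c           ≡⟨ m<n⇒m%n≡m c<n ⟨
    c % suc k   ≡⟨ Equivalence.to (rotate-≡⇔ c d x) eq ⟩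
    d % suc k   ≡⟨ m<n⇒m%n≡m d<n ⟩
    d           ∎)

  rotate-mod : ∀ c i → rotate c (i mod suc k) ≡ (i + c) mod suc k
  rotate-mod c i = toℕ-injective (begin
    toℕ (rotate c (i mod suc k))    ≡⟨ toℕ-rotate c (i mod suc k) ⟩
    (toℕ (i mod suc k) + c) % suc k ≡⟨ cong (λ y → (y + c) % suc k) (toℕ-mod i (suc k)) ⟩
    (i % suc k + c) % suc k         ≡⟨ [m%n+o]%n≡[m+o]%n i c (suc k) ⟩
    (i + c) % suc k                 ≡⟨ toℕ-mod (i + c) (suc k) ⟨
    toℕ ((i + c) mod suc k)         ∎)

  rotate-displacement : ∀ (x y : Fin (suc k)) → rotate (toℕ y + suc k ∸ toℕ x) x ≡ y
  rotate-displacement x y = toℕ-injective (begin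
    toℕ (rotate d x)        ≡⟨ toℕ-rotate d x ⟩
    (toℕ x + d) % suc k     ≡⟨ cong (_% suc k) (m+[n∸m]≡n x≤y+n) ⟩
    (toℕ y + suc k) % suc k ≡⟨ [m+n]%n≡m%n (toℕ y) (suc k) ⟩
    toℕ y % suc k           ≡⟨ m<n⇒m%n≡m (toℕ<n y) ⟩
    toℕ y                   ∎)
    where
    d : ℕ
    d = toℕ y + suc k ∸ toℕ x
    x≤y+n : toℕ x ≤ toℕ y + suc k
    x≤y+n = ≤-trans (<⇒≤ (toℕ<n x)) (m≤n+m (suc k) (toℕ y))

  displacement≡1⇔ : 1 ≤ k → ∀ (x y : Fin (suc k)) →
    (toℕ y + suc k ∸ toℕ x) % suc k ≡ 1 ⇔ y ≡ rotate 1 x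
  displacement≡1⇔ 1≤k x y = mk⇔
    (λ d≡1 → trans (sym (rotate-displacement x y))
                   (Equivalence.from (rotate-≡⇔ d 1 x) (trans d≡1 (sym 1%n≡1))))
    (λ y≡ → trans (Equivalence.to (rotate-≡⇔ d 1 x) (trans (rotate-displacement x y) y≡)) 1%n≡1)
    where
    d : ℕ
    d = toℕ y + suc k ∸ toℕ x
    1%n≡1 : 1 % suc k ≡ 1
    1%n≡1 = m<n⇒m%n≡m (s≤s 1≤k)

  DiffPM1⇔rotate : 1 ≤ k → ∀ (x y : Fin (suc k)) →
    DiffPM1 (suc k) x y ⇔ (y ≡ rotate 1 x ⊎ y ≡ rotate k x)
  DiffPM1⇔rotate 1≤k x y = mk⇔ to from
    where
    to : DiffPM1 (suc k) x y → y ≡ rotate 1 x ⊎ y ≡ rotate k x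
    to (inj₁ d≡1) = inj₁ (Equivalence.to (displacement≡1⇔ 1≤k x y) d≡1)
    to (inj₂ d≡1) = inj₂ (sym (trans (cong (rotate k) (Equivalence.to (displacement≡1⇔ 1≤k y x) d≡1))
                                     (rotate-inverse 1 k y refl)))
    from : y ≡ rotate 1 x ⊎ y ≡ rotate k x → DiffPM1 (suc k) x y
    from (inj₁ y≡) = inj₁ (Equivalence.from (displacement≡1⇔ 1≤k x y) y≡)
    from (inj₂ y≡) = inj₂ (Equivalence.from (displacement≡1⇔ 1≤k y x)
                            (sym (trans (cong (rotate 1) y≡) (rotate-inverse k 1 x (+-comm k 1)))))

-- Weights as sums over neighbourhoods

_when_ : {P : Set} → ℕ → Dec P → ℕ
a when yes _ = a
a when no  _ = 0

module _ {a : ℕ} where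

  when-yes : ∀ {P : Set} (d : Dec P) → P → a when d ≡ a
  when-yes (yes _) _ = refl
  when-yes (no ¬p) p = contradiction p ¬p

  when-no : ∀ {P : Set} (d : Dec P) → ¬ P → a when d ≡ 0
  when-no (yes p) ¬p = contradiction p ¬p
  when-no (no _)  _  = refl

  when-⇔ : ∀ {P Q : Set} (d : Dec P) (e : Dec Q) → P ⇔ Q → a when d ≡ a when e
  when-⇔ (yes p) e P⇔Q = sym (when-yes e (Equivalence.to P⇔Q p))
  when-⇔ (no ¬p) e P⇔Q = sym (when-no e (¬p ∘ Equivalence.from P⇔Q))

module _ {A : Set} where

  sum-map-+ : ∀ (f g : A → ℕ) xs →
    sum (map (λ x → f x + g x) xs) ≡ sum (map f xs) + sum (map g xs)
  sum-map-+ f g []       = refl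
  sum-map-+ f g (x ∷ xs) = trans (cong (f x + g x +_) (sum-map-+ f g xs)) (interchange (f x) (g x) _ _)

  sum-map-zero : ∀ {f : A → ℕ} {xs} → All (λ x → f x ≡ 0) xs → sum (map f xs) ≡ 0
  sum-map-zero []         = refl
  sum-map-zero (fx≡0 ∷ p) = cong₂ _+_ fx≡0 (sum-map-zero p)

module _ {A : Set} (_≟_ : DecidableEquality A) where
  open DecMembership _≟_ using (_∈?_)

  sum-when-≡ : ∀ (g : A → ℕ) {w xs} → Unique xs → w ∈ xs →
    sum (map (λ u → g u when (u ≟ w)) xs) ≡ g w
  sum-when-≡ g {w} {_ ∷ xs} (w≢xs ∷ _) (here refl) = begin
    g w when (w ≟ w) + sum (map (λ u → g u when (u ≟ w)) xs)
      ≡⟨ cong₂ _+_ (when-yes (w ≟ w) refl) (sum-map-zero others) ⟩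
    g w + 0
      ≡⟨ +-identityʳ (g w) ⟩
    g w ∎
    where
    others : All (λ u → g u when (u ≟ w) ≡ 0) xs
    others = All.map (λ {u} w≢u → when-no (u ≟ w) (w≢u ∘ sym)) w≢xs
  sum-when-≡ g {w} {x ∷ _} (x≢xs ∷ xs-unique) (there w∈xs) =
    cong₂ _+_ (when-no (x ≟ w) (All.lookup x≢xs w∈xs)) (sum-when-≡ g xs-unique w∈xs)

  when-∈-∷ : ∀ (g : A → ℕ) {w ws} → All (w ≢_) ws → ∀ u →
    g u when (u ∈? w ∷ ws) ≡ g u when (u ≟ w) + g u when (u ∈? ws)
  when-∈-∷ g {w} {ws} w∉ws u = split (u ≟ w) (u ∈? ws)
    where
    split : (d : Dec (u ≡ w)) (e : Dec (u ∈ ws)) →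
      g u when (u ∈? w ∷ ws) ≡ g u when d + g u when e
    split (yes refl) (yes u∈ws) = contradiction refl (All.lookup w∉ws u∈ws)
    split (yes refl) (no _)     = trans (when-yes (u ∈? w ∷ ws) (here refl)) (sym (+-identityʳ (g u)))
    split (no _)     (yes u∈ws) = when-yes (u ∈? w ∷ ws) (there u∈ws)
    split (no u≢w)   (no u∉ws)  = when-no (u ∈? w ∷ ws) λ { (here u≡w) → u≢w u≡w ; (there u∈ws) → u∉ws u∈ws }

  sum-when-∈ : ∀ (g : A → ℕ) {xs ws} → Unique xs → (∀ w → w ∈ xs) → Unique ws →
    sum (map (λ u → g u when (u ∈? ws)) xs) ≡ sum (map g ws)
  sum-when-∈ g {xs} _ _ [] = sum-map-zero (All.universal (λ _ → refl) xs)
  sum-when-∈ g {xs} {w ∷ ws} xs-unique complete (w∉ws ∷ ws-unique) = begin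
    sum (map (λ u → g u when (u ∈? w ∷ ws)) xs)
      ≡⟨ cong sum (map-cong (when-∈-∷ g w∉ws) xs) ⟩
    sum (map (λ u → g u when (u ≟ w) + g u when (u ∈? ws)) xs)
      ≡⟨ sum-map-+ (λ u → g u when (u ≟ w)) (λ u → g u when (u ∈? ws)) xs ⟩
    sum (map (λ u → g u when (u ≟ w)) xs) + sum (map (λ u → g u when (u ∈? ws)) xs)
      ≡⟨ cong₂ _+_ (sum-when-≡ g xs-unique (complete w)) (sum-when-∈ g xs-unique complete ws-unique) ⟩
    g w + sum (map g ws) ∎

open FinGraph using (V; verts; Adj; adj?)

mutual
  weight≡sum-when : (G : FinGraph) (ℓ : V G → ℕ) (v : V G) →
    weight G ℓ v ≡ sum (map (λ u → ℓ u when adj? G v u) (verts G))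
  weight≡sum-when G ℓ v = cong sum (map-cong (weight-summand G ℓ v) (verts G))

  -- The summand of weight is a where-bound function of Defs that cannot be named
  -- here; the underscore is solved from its use in weight≡sum-when.
  weight-summand : (G : FinGraph) (ℓ : V G → ℕ) (v u : V G) → _ ≡ ℓ u when adj? G v u
  weight-summand G ℓ v u with adj? G v u
  ... | yes _ = refl
  ... | no  _ = refl

weight≡sum-neighbours : (G : FinGraph) → DecidableEquality (V G) →
  Unique (verts G) → (∀ v → v ∈ verts G) →
  (N : V G → List (V G)) → (∀ v → Unique (N v)) → (∀ v u → Adj G v u ⇔ u ∈ N v) →
  ∀ ℓ v → weight G ℓ v ≡ sum (map ℓ (N v))
weight≡sum-neighbours G _≟_ verts-unique complete N N-unique Adj⇔∈N ℓ v = begin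
  weight G ℓ v                                     ≡⟨ weight≡sum-when G ℓ v ⟩
  sum (map (λ u → ℓ u when adj? G v u) (verts G))  ≡⟨ cong sum (map-cong adj≗∈ (verts G)) ⟩
  sum (map (λ u → ℓ u when (u ∈? N v)) (verts G))  ≡⟨ sum-when-∈ _≟_ ℓ verts-unique complete (N-unique v) ⟩
  sum (map ℓ (N v))                                ∎
  where
  open DecMembership _≟_ using (_∈?_)
  adj≗∈ : ∀ u → ℓ u when adj? G v u ≡ ℓ u when (u ∈? N v)
  adj≗∈ u = when-⇔ (adj? G v u) (u ∈? N v) (Adj⇔∈N v u)

sum-four : ∀ a b c d → a + (b + (c + (d + 0))) ≡ a + b + c + d
sum-four = solve-∀

module _ {m n : ℕ} where

  cycleNeighbours : Fin (suc m) × Fin (suc n) → List (Fin (suc m) × Fin (suc n))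
  cycleNeighbours (a , b) = (rotate 1 a , b) ∷ (rotate m a , b) ∷ (a , rotate 1 b) ∷ (a , rotate n b) ∷ []

  CycleAdj⇔∈cycleNeighbours : 1 ≤ m → 1 ≤ n → ∀ v u →
    CycleAdj (suc m) (suc n) v u ⇔ u ∈ cycleNeighbours v
  CycleAdj⇔∈cycleNeighbours 1≤m 1≤n (a , b) (c , d) = mk⇔ to from
    where
    to : CycleAdj (suc m) (suc n) (a , b) (c , d) → (c , d) ∈ cycleNeighbours (a , b)
    to (inj₁ (a~c , refl)) with Equivalence.to (DiffPM1⇔rotate 1≤m a c) a~c
    ... | inj₁ refl = here refl
    ... | inj₂ refl = there (here refl)
    to (inj₂ (refl , b~d)) with Equivalence.to (DiffPM1⇔rotate 1≤n b d) b~d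
    ... | inj₁ refl = there (there (here refl))
    ... | inj₂ refl = there (there (there (here refl)))
    from : (c , d) ∈ cycleNeighbours (a , b) → CycleAdj (suc m) (suc n) (a , b) (c , d)
    from (here refl)                         = inj₁ (Equivalence.from (DiffPM1⇔rotate 1≤m a c) (inj₁ refl) , refl)
    from (there (here refl))                 = inj₁ (Equivalence.from (DiffPM1⇔rotate 1≤m a c) (inj₂ refl) , refl)
    from (there (there (here refl)))         = inj₂ (refl , Equivalence.from (DiffPM1⇔rotate 1≤n b d) (inj₁ refl))
    from (there (there (there (here refl)))) = inj₂ (refl , Equivalence.from (DiffPM1⇔rotate 1≤n b d) (inj₂ refl))

  cycleNeighbours-unique : 2 ≤ m → 2 ≤ n → ∀ v → Unique (cycleNeighbours v)
  cycleNeighbours-unique 2≤m 2≤n (a , b) =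
    (a₁≢a₋ ∘ cong proj₁ ∷ a₁≢a ∘ cong proj₁ ∷ a₁≢a ∘ cong proj₁ ∷ []) ∷
    (a₋≢a ∘ cong proj₁ ∷ a₋≢a ∘ cong proj₁ ∷ []) ∷
    (b₁≢b₋ ∘ cong proj₂ ∷ []) ∷ [] ∷ []
    where
    rotate≢id : ∀ {k c} (x : Fin (suc k)) → 0 < c → c < suc k → rotate c x ≢ x
    rotate≢id x 0<c c<n eq = rotate-≢ x c<n z<s (>⇒≢ 0<c) (trans eq (sym (rotate-zero x)))
    a₁≢a₋ : rotate 1 a ≢ rotate m a
    a₁≢a₋ = rotate-≢ a (s≤s (<⇒≤ 2≤m)) ≤-refl (<⇒≢ 2≤m)
    a₁≢a : rotate 1 a ≢ a
    a₁≢a = rotate≢id a z<s (s≤s (<⇒≤ 2≤m))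
    a₋≢a : rotate m a ≢ a
    a₋≢a = rotate≢id a (<⇒≤ 2≤m) ≤-refl
    b₁≢b₋ : rotate 1 b ≢ rotate n b
    b₁≢b₋ = rotate-≢ b (s≤s (<⇒≤ 2≤n)) ≤-refl (<⇒≢ 2≤n)

  weight-CmCn : 2 ≤ m → 2 ≤ n → ∀ ℓ v →
    weight (CmCn (suc m) (suc n)) ℓ v ≡ sum (map ℓ (cycleNeighbours v))
  weight-CmCn 2≤m 2≤n = weight≡sum-neighbours (CmCn (suc m) (suc n)) (≡-dec Fin._≟_ Fin._≟_)
    (cartesianProduct⁺ (allFin⁺ (suc m)) (allFin⁺ (suc n)))
    (λ (a , b) → ∈-cartesianProduct⁺ (∈-allFin a) (∈-allFin b))
    cycleNeighbours (cycleNeighbours-unique 2≤m 2≤n)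
    (CycleAdj⇔∈cycleNeighbours (<⇒≤ 2≤m) (<⇒≤ 2≤n))

-- Necessity

ArithmeticProgression : (ℕ → ℕ) → Set
ArithmeticProgression f = ∀ t → f t + f (2 + t) ≡ f (1 + t) + f (1 + t)

module _ (f : ℕ → ℕ) (f-ap : ArithmeticProgression f) where

  ap-difference : ∀ t → f (1 + t) + f 0 ≡ f t + f 1
  ap-difference zero    = +-comm (f 1) (f 0)
  ap-difference (suc t) = +-cancelʳ-≡ (f t) _ _ (begin
    f (2 + t) + f 0 + f t         ≡⟨ cycle-terms (f (2 + t)) (f 0) (f t) ⟩
    f t + f (2 + t) + f 0         ≡⟨ cong (_+ f 0) (f-ap t) ⟩
    f (1 + t) + f (1 + t) + f 0   ≡⟨ +-assoc (f (1 + t)) _ _ ⟩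
    f (1 + t) + (f (1 + t) + f 0) ≡⟨ cong (f (1 + t) +_) (ap-difference t) ⟩
    f (1 + t) + (f t + f 1)       ≡⟨ x∙yz≈xz∙y (f (1 + t)) (f t) (f 1) ⟩
    f (1 + t) + f 1 + f t         ∎)
    where
    cycle-terms : ∀ a b c → a + b + c ≡ c + a + b
    cycle-terms = solve-∀

  ap-closed-form : ∀ t → f t + t * f 0 ≡ f 0 + t * f 1
  ap-closed-form zero    = refl
  ap-closed-form (suc t) = begin
    f (1 + t) + (f 0 + t * f 0) ≡⟨ +-assoc (f (1 + t)) (f 0) _ ⟨
    f (1 + t) + f 0 + t * f 0   ≡⟨ cong (_+ t * f 0) (ap-difference t) ⟩
    f t + f 1 + t * f 0         ≡⟨ xy∙z≈xz∙y (f t) (f 1) _ ⟩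
    f t + t * f 0 + f 1         ≡⟨ cong (_+ f 1) (ap-closed-form t) ⟩
    f 0 + t * f 1 + f 1         ≡⟨ xy∙z≈xz∙y (f 0) _ (f 1) ⟩
    f 0 + f 1 + t * f 1         ≡⟨ +-assoc (f 0) (f 1) _ ⟩
    f 0 + (f 1 + t * f 1)       ∎

  ap-periodic⇒constant : ∀ r → f (suc r) ≡ f 0 → f 1 ≡ f 0
  ap-periodic⇒constant r f[1+r]≡f0 = sym (*-cancelˡ-≡ (f 0) (f 1) (suc r) (+-cancelˡ-≡ (f 0) _ _ (begin
    f 0 + suc r * f 0       ≡⟨ cong (_+ suc r * f 0) f[1+r]≡f0 ⟨
    f (suc r) + suc r * f 0 ≡⟨ ap-closed-form (suc r) ⟩
    f 0 + suc r * f 1       ∎)))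

-- In ℤ: h − g changes sign at each step, so it is 2-periodic.
alternating-difference : ∀ (g h : ℕ → ℕ) → (∀ t → h t + h (1 + t) ≡ g t + g (1 + t)) →
  ∀ t → h 0 + g (2 * t) ≡ g 0 + h (2 * t)
alternating-difference g h alt zero    = +-comm (h 0) (g 0)
alternating-difference g h alt (suc t) rewrite *-suc 2 t = +-cancelʳ-≡ (h s + g s) _ _ (begin
  h 0 + g (2 + s) + (h s + g s)   ≡⟨ shuffle (h 0) (g (2 + s)) (h s) (g s) ⟩
  (h 0 + g s) + (h s + g (2 + s)) ≡⟨ cong₂ _+_ (alternating-difference g h alt t) two-steps ⟩
  (g 0 + h s) + (g s + h (2 + s)) ≡⟨ shuffle₂ (g 0) (h s) (g s) (h (2 + s)) ⟩
  g 0 + h (2 + s) + (h s + g s)   ∎)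
  where
  s : ℕ
  s = 2 * t
  shuffle : ∀ a b c d → a + b + (c + d) ≡ (a + d) + (c + b)
  shuffle = solve-∀
  shuffle₂ : ∀ a b c d → a + b + (c + d) ≡ a + d + (b + c)
  shuffle₂ = solve-∀
  two-steps : h s + g (2 + s) ≡ g s + h (2 + s)
  two-steps = +-cancelʳ-≡ (h (1 + s) + g (1 + s)) _ _ (begin
    h s + g (2 + s) + (h (1 + s) + g (1 + s))   ≡⟨ shuffle′ (h s) (g (2 + s)) (h (1 + s)) (g (1 + s)) ⟩
    (h s + h (1 + s)) + (g (1 + s) + g (2 + s)) ≡⟨ cong₂ _+_ (alt s) (sym (alt (1 + s))) ⟩
    (g s + g (1 + s)) + (h (1 + s) + h (2 + s)) ≡⟨ shuffle″ (g s) (g (1 + s)) (h (1 + s)) (h (2 + s)) ⟩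
    g s + h (2 + s) + (h (1 + s) + g (1 + s))   ∎)
    where
    shuffle′ : ∀ a b c d → a + b + (c + d) ≡ (a + c) + (d + b)
    shuffle′ = solve-∀
    shuffle″ : ∀ a b c d → (a + b) + (c + d) ≡ a + d + (c + b)
    shuffle″ = solve-∀

module Necessity (m′ n′ : ℕ) (G : ℕ → ℕ → ℕ) (w : ℕ)
  (periodicˡ : ∀ i j → G (i + suc m′) j ≡ G i j)
  (periodicʳ : ∀ i j → G i (j + suc n′) ≡ G i j)
  (magic : ∀ i j → G (i + 1) j + G (i + m′) j + G i (j + 1) + G i (j + n′) ≡ w)
  (injective-at-origin : ∀ i j → G i j ≡ G 0 0 → i % suc m′ ≡ 0 × j % suc n′ ≡ 0)
  where

  -- i + m′ and j + n′ stand for i − 1 and j − 1.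

  private
    m n : ℕ
    m = suc m′
    n = suc n′

  G-periodicˡ : ∀ c i j → G (i + c * m) j ≡ G i j
  G-periodicˡ zero    i j = cong (λ x → G x j) (+-identityʳ i)
  G-periodicˡ (suc c) i j = begin
    G (i + (m + c * m)) j ≡⟨ cong (λ x → G x j) (x∙yz≈xz∙y i m (c * m)) ⟩
    G (i + c * m + m) j   ≡⟨ periodicˡ (i + c * m) j ⟩
    G (i + c * m) j       ≡⟨ G-periodicˡ c i j ⟩
    G i j                 ∎

  G-periodicʳ : ∀ c i j → G i (j + c * n) ≡ G i j
  G-periodicʳ zero    i j = cong (G i) (+-identityʳ j)
  G-periodicʳ (suc c) i j = begin
    G i (j + (n + c * n)) ≡⟨ cong (G i) (x∙yz≈xz∙y j n (c * n)) ⟩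
    G i (j + c * n + n)   ≡⟨ periodicʳ i (j + c * n) ⟩
    G i (j + c * n)       ≡⟨ G-periodicʳ c i j ⟩
    G i j                 ∎

  diag : ℕ → ℕ → ℕ
  diag i j = G i j + G (suc i) (suc j)

  diag-periodicˡ : ∀ c i j → diag (i + c * m) j ≡ diag i j
  diag-periodicˡ c i j = cong₂ _+_ (G-periodicˡ c i j) (G-periodicˡ c (suc i) (suc j))

  diag-periodicʳ : ∀ c i j → diag i (j + c * n) ≡ diag i j
  diag-periodicʳ c i j = cong₂ _+_ (G-periodicʳ c i j) (G-periodicʳ c (suc i) (suc j))

  diag-magic : ∀ i j → diag i (suc j) + diag (suc i) j ≡ w
  diag-magic i j = begin
    diag i (suc j) + diag (suc i) j
      ≡⟨ regroup (G (2 + i) (suc j)) (G i (suc j)) (G (suc i) (2 + j)) (G (suc i) j) ⟩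
    G (2 + i) (suc j) + G i (suc j) + G (suc i) (2 + j) + G (suc i) j
      ≡⟨ cong₂ _+_ (cong₂ _+_ (cong₂ _+_ right left) up) down ⟨
    G (suc i + 1) (suc j) + G (suc i + m′) (suc j) + G (suc i) (suc j + 1) + G (suc i) (suc j + n′)
      ≡⟨ magic (suc i) (suc j) ⟩
    w ∎
    where
    regroup : ∀ a b c d → (b + c) + (d + a) ≡ a + b + c + d
    regroup = solve-∀
    right : G (suc i + 1) (suc j) ≡ G (2 + i) (suc j)
    right = cong (λ x → G x (suc j)) (+-comm (suc i) 1)
    left : G (suc i + m′) (suc j) ≡ G i (suc j)
    left = trans (cong (λ x → G x (suc j)) (sym (+-suc i m′))) (periodicˡ i (suc j))
    up : G (suc i) (suc j + 1) ≡ G (suc i) (2 + j)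
    up = cong (G (suc i)) (+-comm (suc j) 1)
    down : G (suc i) (suc j + n′) ≡ G (suc i) j
    down = trans (cong (G (suc i)) (sym (+-suc j n′))) (periodicʳ (suc i) j)

  diag-shift : ∀ t i j → diag (2 * t + i) j ≡ diag i (2 * t + j)
  diag-shift zero    i j = refl
  diag-shift (suc t) i j = begin
    diag (2 * suc t + i) j   ≡⟨ cong (λ x → diag (x + i) j) (*-suc 2 t) ⟩
    diag (2 + (2 * t + i)) j ≡⟨ shift₂ (2 * t + i) j ⟩
    diag (2 * t + i) (2 + j) ≡⟨ diag-shift t i (2 + j) ⟩
    diag i (2 * t + (2 + j)) ≡⟨ cong (diag i) (x∙yz≈y∙xz (2 * t) 2 j) ⟩
    diag i (2 + 2 * t + j)   ≡⟨ cong (λ x → diag i (x + j)) (*-suc 2 t) ⟨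
    diag i (2 * suc t + j)   ∎
    where
    shift₂ : ∀ i j → diag (2 + i) j ≡ diag i (2 + j)
    shift₂ i j = +-cancelˡ-≡ (diag (suc i) (suc j)) _ _
      (trans (diag-magic (suc i) j) (sym (trans (+-comm (diag (suc i) (suc j)) _) (diag-magic i (suc j)))))

  module _ (cx cy s : ℕ)
    (diag-invariant : ∀ i j → diag (i + cx) (j + cy) ≡ diag i j)
    (G-invariant : ∀ i j → G (2 * s + i) (2 * s + j) ≡ G (i + cx) (j + cy))
    where

    translation-midpoint : ∀ i j →
      G (i + cx) (j + cy) + G (i + cx) (j + cy) ≡ G i j + G (i + cx + cx) (j + cy + cy)
    translation-midpoint i j = begin
      G (i + cx) (j + cy) + G (i + cx) (j + cy)       ≡⟨ cong (G (i + cx) (j + cy) +_) (G-invariant i j) ⟨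
      G (i + cx) (j + cy) + G (2 * s + i) (2 * s + j) ≡⟨ alternating-difference g h (λ t → diag-invariant (t + i) (t + j)) s ⟩
      G i j + G (2 * s + i + cx) (2 * s + j + cy)     ≡⟨ cong₂ (λ x y → G i j + G x y) (+-assoc (2 * s) i cx) (+-assoc (2 * s) j cy) ⟩
      G i j + G (2 * s + (i + cx)) (2 * s + (j + cy)) ≡⟨ cong (G i j +_) (G-invariant (i + cx) (j + cy)) ⟩
      G i j + G (i + cx + cx) (j + cy + cy)           ∎
      where
      g h : ℕ → ℕ
      g t = G (t + i) (t + j)
      h t = G (t + i + cx) (t + j + cy)

    translation-trivial : cx % m ≡ 0 × cy % n ≡ 0
    translation-trivial = injective-at-origin cx cy (begin
      G cx cy ≡⟨ cong₂ G (*-identityˡ cx) (*-identityˡ cy) ⟨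
      f 1     ≡⟨ ap-periodic⇒constant f f-ap (n′ + m′ * n) f-period ⟩
      f 0     ∎)
      where
      f : ℕ → ℕ
      f t = G (t * cx) (t * cy)
      once : ∀ t c → (1 + t) * c ≡ t * c + c
      once t c = +-comm c (t * c)
      twice : ∀ t c → (2 + t) * c ≡ t * c + c + c
      twice = solve-∀
      f-ap : ArithmeticProgression f
      f-ap t = begin
        f t + f (2 + t)
          ≡⟨ cong (f t +_) (cong₂ G (twice t cx) (twice t cy)) ⟩
        f t + G (t * cx + cx + cx) (t * cy + cy + cy)
          ≡⟨ translation-midpoint (t * cx) (t * cy) ⟨
        G (t * cx + cx) (t * cy + cy) + G (t * cx + cx) (t * cy + cy)
          ≡⟨ cong₂ _+_ f[1+t] f[1+t] ⟨
        f (1 + t) + f (1 + t) ∎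
        where
        f[1+t] : f (1 + t) ≡ G (t * cx + cx) (t * cy + cy)
        f[1+t] = cong₂ G (once t cx) (once t cy)
      reassocˡ : ∀ m n c → m * n * c ≡ 0 + n * c * m
      reassocˡ = solve-∀
      reassocʳ : ∀ m n c → m * n * c ≡ 0 + m * c * n
      reassocʳ = solve-∀
      f-period : f (m * n) ≡ f 0
      f-period = begin
        G (m * n * cx) (m * n * cy)               ≡⟨ cong₂ G (reassocˡ m n cx) (reassocʳ m n cy) ⟩
        G (0 + (n * cx) * m) (0 + (m * cy) * n)   ≡⟨ G-periodicˡ (n * cx) 0 _ ⟩
        G 0 (0 + (m * cy) * n)                    ≡⟨ G-periodicʳ (m * cy) 0 0 ⟩
        G 0 0                                     ∎

  vertical-period : ∀ s → m ∣ 2 * s → n ∣ 2 * s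
  vertical-period s (divides q 2s≡qm) =
    m%n≡0⇒n∣m (2 * s) n (proj₂ (translation-trivial 0 (2 * s) s diag-invariant G-invariant))
    where
    2s+i≡i+qm : ∀ i → 2 * s + i ≡ i + q * m
    2s+i≡i+qm i = trans (+-comm (2 * s) i) (cong (i +_) 2s≡qm)
    diag-invariant : ∀ i j → diag (i + 0) (j + 2 * s) ≡ diag i j
    diag-invariant i j = begin
      diag (i + 0) (j + 2 * s) ≡⟨ cong₂ diag (+-identityʳ i) (+-comm j (2 * s)) ⟩
      diag i (2 * s + j)       ≡⟨ diag-shift s i j ⟨
      diag (2 * s + i) j       ≡⟨ cong (λ x → diag x j) (2s+i≡i+qm i) ⟩
      diag (i + q * m) j       ≡⟨ diag-periodicˡ q i j ⟩
      diag i j                 ∎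
    G-invariant : ∀ i j → G (2 * s + i) (2 * s + j) ≡ G (i + 0) (j + 2 * s)
    G-invariant i j = begin
      G (2 * s + i) (2 * s + j) ≡⟨ cong (λ x → G x (2 * s + j)) (2s+i≡i+qm i) ⟩
      G (i + q * m) (2 * s + j) ≡⟨ G-periodicˡ q i (2 * s + j) ⟩
      G i (2 * s + j)           ≡⟨ cong₂ G (+-identityʳ i) (+-comm j (2 * s)) ⟨
      G (i + 0) (j + 2 * s)     ∎

  n∣2m : n ∣ 2 * m
  n∣2m = vertical-period m (n∣m*n 2)

  n≡2m⇒m-odd : n ≡ 2 * m → m % 2 ≡ 1
  n≡2m⇒m-odd n≡2m with %2-dichotomy m
  ... | inj₂ m-odd  = m-odd
  ... | inj₁ m-even = contradiction (∣⇒≤ n∣m) (<⇒≱ m<n)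
    where
    m≡2t : m ≡ 2 * (m / 2)
    m≡2t = trans (m≡m%n+[m/n]*n m 2) (trans (cong (_+ m / 2 * 2) m-even) (*-comm (m / 2) 2))
    n∣m : n ∣ m
    n∣m = subst (n ∣_) (sym m≡2t) (vertical-period (m / 2) (subst (m ∣_) m≡2t ∣-refl))
    m<n : m < n
    m<n = subst (m <_) (sym n≡2m) (m<m+n m z<s)

  n≡m⇒4∤m : n ≡ m → ¬ 4 ∣ m
  n≡m⇒4∤m n≡m (divides (suc u) m≡4u) = 0≢1+n (sym c≡0)
    where
    c : ℕ
    c = 2 * suc u
    c+c≡n : c + c ≡ 1 * n
    c+c≡n = trans (double (suc u)) (trans (sym m≡4u) (trans (sym n≡m) (sym (+-identityʳ n))))
      where
      double : ∀ u → 2 * u + 2 * u ≡ u * 4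
      double = solve-∀
    diag-invariant : ∀ i j → diag (i + c) (j + c) ≡ diag i j
    diag-invariant i j = begin
      diag (i + c) (j + c)    ≡⟨ cong (λ x → diag x (j + c)) (+-comm i c) ⟩
      diag (c + i) (j + c)    ≡⟨ diag-shift (suc u) i (j + c) ⟩
      diag i (c + (j + c))    ≡⟨ cong (diag i) (x∙yz≈y∙xz c j c) ⟩
      diag i (j + (c + c))    ≡⟨ cong (λ x → diag i (j + x)) c+c≡n ⟩
      diag i (j + 1 * n)      ≡⟨ diag-periodicʳ 1 i j ⟩
      diag i j                ∎
    G-invariant : ∀ i j → G (2 * suc u + i) (2 * suc u + j) ≡ G (i + c) (j + c)
    G-invariant i j = cong₂ G (+-comm c i) (+-comm c j)
    c<m : c < m
    c<m = subst (c <_) (trans c+c≡n (trans (+-identityʳ n) n≡m)) (m<m+n c z<s)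
    c≡0 : c ≡ 0
    c≡0 = trans (sym (m<n⇒m%n≡m c<m)) (proj₁ (translation-trivial c c (suc u) diag-invariant G-invariant))

  n≡m⇒m-even : 2 ≤ m′ → n ≡ m → m % 2 ≡ 0
  n≡m⇒m-even 2≤m′ n≡m with %2-dichotomy m
  ... | inj₁ m-even = m-even
  ... | inj₂ m-odd  = ⊥-elim (0≢1+n (sym 2≡0))
    where
    u : ℕ
    u = m / 2
    1+2u≡1m : 1 + 2 * u ≡ 1 * m
    1+2u≡1m = begin
      1 + 2 * u     ≡⟨ cong (1 +_) (*-comm 2 u) ⟩
      1 + u * 2     ≡⟨ cong (_+ u * 2) m-odd ⟨
      m % 2 + u * 2 ≡⟨ m≡m%n+[m/n]*n m 2 ⟨
      m             ≡⟨ +-identityʳ m ⟨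
      1 * m         ∎
    diag-doubled : ∀ i j → 2 * diag i j ≡ w
    diag-doubled i j = begin
      diag i j + (diag i j + 0)                           ≡⟨ cong (diag i j +_) (+-identityʳ (diag i j)) ⟩
      diag i j + diag i j                                 ≡⟨ cong₂ _+_ vertical horizontal ⟨
      diag i (suc (2 * u + j)) + diag (suc i) (2 * u + j) ≡⟨ diag-magic i (2 * u + j) ⟩
      w                                                   ∎
      where
      vertical : diag i (suc (2 * u + j)) ≡ diag i j
      vertical = begin
        diag i (1 + 2 * u + j)   ≡⟨ cong (diag i) (+-comm (1 + 2 * u) j) ⟩
        diag i (j + (1 + 2 * u)) ≡⟨ cong (λ x → diag i (j + x)) (trans 1+2u≡1m (cong (1 *_) (sym n≡m))) ⟩
        diag i (j + 1 * n)       ≡⟨ diag-periodicʳ 1 i j ⟩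
        diag i j                 ∎
      horizontal : diag (suc i) (2 * u + j) ≡ diag i j
      horizontal = begin
        diag (suc i) (2 * u + j) ≡⟨ diag-shift u (suc i) j ⟨
        diag (2 * u + suc i) j   ≡⟨ cong (λ x → diag x j) (trans (+-suc (2 * u) i) (+-comm (1 + 2 * u) i)) ⟩
        diag (i + (1 + 2 * u)) j ≡⟨ cong (λ x → diag (i + x) j) 1+2u≡1m ⟩
        diag (i + 1 * m) j       ≡⟨ diag-periodicˡ 1 i j ⟩
        diag i j                 ∎
    diag00≡diag11 : diag 0 0 ≡ diag 1 1
    diag00≡diag11 = *-cancelˡ-≡ (diag 0 0) (diag 1 1) 2 (trans (diag-doubled 0 0) (sym (diag-doubled 1 1)))
    G22≡G00 : G 2 2 ≡ G 0 0
    G22≡G00 = sym (+-cancelˡ-≡ (G 1 1) _ _ (trans (+-comm (G 1 1) (G 0 0)) diag00≡diag11))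
    2≡0 : 2 ≡ 0
    2≡0 = trans (sym (m<n⇒m%n≡m (s≤s 2≤m′))) (proj₁ (injective-at-origin 2 2 G22≡G00))

  conditions : 2 ≤ m′ → m ≤ n → (n ≡ 2 * m × m % 2 ≡ 1) ⊎ (n ≡ m × m % 4 ≡ 2)
  conditions 2≤m′ m≤n with ∣2*⇒≡2*⊎≡ z<s m≤n n∣2m
  ... | inj₁ n≡2m = inj₁ (n≡2m , n≡2m⇒m-odd n≡2m)
  ... | inj₂ n≡m  = inj₂ (n≡m , even∧4∤⇒%4≡2 m (n≡m⇒m-even 2≤m′ n≡m) (n≡m⇒4∤m n≡m))

distanceMagic⇒conditions : ∀ m′ n′ → 2 ≤ m′ → suc m′ ≤ suc n′ → DistanceMagic (CmCn (suc m′) (suc n′)) →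
  (suc n′ ≡ 2 * suc m′ × suc m′ % 2 ≡ 1) ⊎ (suc n′ ≡ suc m′ × suc m′ % 4 ≡ 2)
distanceMagic⇒conditions m′ n′ 2≤m′ m≤n (ℓ , (ℓ-injective , _) , w , weight≡w) =
  Necessity.conditions m′ n′ G w periodicˡ periodicʳ magic injective-at-origin 2≤m′ m≤n
  where
  m n : ℕ
  m = suc m′
  n = suc n′
  L : Fin m × Fin n → ℕ
  L u = suc (toℕ (ℓ u))
  G : ℕ → ℕ → ℕ
  G i j = L (i mod m , j mod n)
  periodicˡ : ∀ i j → G (i + m) j ≡ G i j
  periodicˡ i j = cong (λ a → L (a , j mod n)) (mod-cong (i + m) i m ([m+n]%n≡m%n i m))
  periodicʳ : ∀ i j → G i (j + n) ≡ G i j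
  periodicʳ i j = cong (λ b → L (i mod m , b)) (mod-cong (j + n) j n ([m+n]%n≡m%n j n))
  magic : ∀ i j → G (i + 1) j + G (i + m′) j + G i (j + 1) + G i (j + n′) ≡ w
  magic i j = begin
    G (i + 1) j + G (i + m′) j + G i (j + 1) + G i (j + n′)
      ≡⟨ cong₂ _+_ (cong₂ _+_ (cong₂ _+_ (horizontal 1) (horizontal m′)) (vertical 1)) (vertical n′) ⟨
    L (rotate 1 a , b) + L (rotate m′ a , b) + L (a , rotate 1 b) + L (a , rotate n′ b)
      ≡⟨ sum-four (L (rotate 1 a , b)) (L (rotate m′ a , b)) (L (a , rotate 1 b)) (L (a , rotate n′ b)) ⟨
    sum (map L (cycleNeighbours (a , b)))
      ≡⟨ weight-CmCn 2≤m′ (≤-trans 2≤m′ (s≤s⁻¹ m≤n)) L (a , b) ⟨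
    weight (CmCn m n) L (a , b)
      ≡⟨ weight≡w (a , b) ⟩
    w ∎
    where
    a : Fin m
    a = i mod m
    b : Fin n
    b = j mod n
    horizontal : ∀ c → L (rotate c a , b) ≡ G (i + c) j
    horizontal c = cong (λ x → L (x , b)) (rotate-mod c i)
    vertical : ∀ c → L (a , rotate c b) ≡ G i (j + c)
    vertical c = cong (λ y → L (a , y)) (rotate-mod c j)
  injective-at-origin : ∀ i j → G i j ≡ G 0 0 → i % m ≡ 0 × j % n ≡ 0
  injective-at-origin i j G≡G00 =
    trans (sym (toℕ-mod i m)) (cong (toℕ ∘ proj₁) at-origin) ,
    trans (sym (toℕ-mod j n)) (cong (toℕ ∘ proj₂) at-origin)
    where
    at-origin : (i mod m , j mod n) ≡ (0 mod m , 0 mod n)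
    at-origin = ℓ-injective (toℕ-injective (suc-injective G≡G00))

-- Sufficiency

Fin-injective⇒surjective : ∀ {N} {f : Fin N → Fin N} → Injective _≡_ _≡_ f → StrictlySurjective _≡_ f
Fin-injective⇒surjective {suc N} {f} f-injective y with any? (λ x → f x Fin.≟ y)
... | yes hit  = hit
... | no  miss = contradiction (injective⇒≤ punched-injective) 1+n≰n
  where
  y≢f : ∀ x → y ≢ f x
  y≢f x y≡fx = miss (x , sym y≡fx)
  punched : Fin (suc N) → Fin N
  punched x = Fin.punchOut (y≢f x)
  punched-injective : Injective _≡_ _≡_ punched
  punched-injective {x} {x′} eq = f-injective (punchOut-injective (y≢f x) (y≢f x′) eq)

Fin-surjective⇒injective : ∀ {N} {f : Fin N → Fin N} → StrictlySurjective _≡_ f → Injective _≡_ _≡_ f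
Fin-surjective⇒injective {N} {f} f-surjective {x} {x′} fx≡fx′ = begin
  x            ≡⟨ section-y≡x ⟨
  section y    ≡⟨ cong section y≡y′ ⟩
  section y′   ≡⟨ section-y′≡x′ ⟩
  x′           ∎
  where
  section : Fin N → Fin N
  section y = proj₁ (f-surjective y)
  f∘section : ∀ y → f (section y) ≡ y
  f∘section y = proj₂ (f-surjective y)
  section-injective : Injective _≡_ _≡_ section
  section-injective {y} {y′} eq = trans (sym (f∘section y)) (trans (cong f eq) (f∘section y′))
  y y′ : Fin N
  y  = proj₁ (Fin-injective⇒surjective section-injective x)
  y′ = proj₁ (Fin-injective⇒surjective section-injective x′)
  section-y≡x : section y ≡ x
  section-y≡x = proj₂ (Fin-injective⇒surjective section-injective x)
  section-y′≡x′ : section y′ ≡ x′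
  section-y′≡x′ = proj₂ (Fin-injective⇒surjective section-injective x′)
  y≡y′ : y ≡ y′
  y≡y′ = begin
    y              ≡⟨ f∘section y ⟨
    f (section y)  ≡⟨ cong f section-y≡x ⟩
    f x            ≡⟨ fx≡fx′ ⟩
    f x′           ≡⟨ cong f section-y′≡x′ ⟨
    f (section y′) ≡⟨ f∘section y′ ⟩
    y′             ∎

surjective⇒bijective : ∀ {m n} {ℓ : Fin m × Fin n → Fin (m * n)} →
  StrictlySurjective _≡_ ℓ → Bijective _≡_ _≡_ ℓ
surjective⇒bijective {m} {n} {ℓ} ℓ-surjective = ℓ-injective , strictlySurjective⇒surjective ℓ-surjective
  where
  ℓ∘remQuot : Fin (m * n) → Fin (m * n)
  ℓ∘remQuot = ℓ ∘ Fin.remQuot n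
  ℓ∘remQuot-surjective : StrictlySurjective _≡_ ℓ∘remQuot
  ℓ∘remQuot-surjective y with ℓ-surjective y
  ... | (a , b) , ℓab≡y = Fin.combine a b , trans (cong ℓ (remQuot-combine a b)) ℓab≡y
  ℓ-injective : Injective _≡_ _≡_ ℓ
  ℓ-injective {a , b} {c , d} ℓab≡ℓcd = begin
    (a , b)                          ≡⟨ remQuot-combine a b ⟨
    Fin.remQuot n (Fin.combine a b)  ≡⟨ cong (Fin.remQuot n) (Fin-surjective⇒injective ℓ∘remQuot-surjective combined) ⟩
    Fin.remQuot n (Fin.combine c d)  ≡⟨ remQuot-combine c d ⟩
    (c , d)                          ∎
    where
    combined : ℓ∘remQuot (Fin.combine a b) ≡ ℓ∘remQuot (Fin.combine c d)
    combined = trans (cong ℓ (remQuot-combine a b)) (trans ℓab≡ℓcd (cong ℓ (sym (remQuot-combine c d))))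

module Construction (m′ r′ : ℕ) (2≤m′ : 2 ≤ m′) (1≤r′ : 1 ≤ r′)
  (r-odd : suc r′ % 2 ≡ 1) (m∣2r : suc m′ ∣ 2 * suc r′)
  (A B : ℕ → ℕ)
  (A+B<H : ∀ s t → s < suc m′ → t < suc m′ → A s + B t < suc m′ * suc r′)
  (A+B-onto : ∀ k → k < suc m′ * suc r′ → ∃₂ λ s j → s < suc m′ × A s + B ((s + 2 * j) % suc m′) ≡ k)
  where

  m r n n′ H : ℕ
  m  = suc m′
  r  = suc r′
  n  = 2 * r
  n′ = pred n
  H  = m * r

  open _∣_ m∣2r renaming (quotient to q; equality to n≡qm)

  -- Since m′ ≡ −1 (mod m), i ⊖ j is i − j mod m.
  _⊖_ _⊕_ : ℕ → ℕ → ℕ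
  i ⊖ j = (i + m′ * j) % m
  i ⊕ j = (i + j) % m

  K : ℕ → ℕ → ℕ
  K i j = A (i ⊖ j) + B (i ⊕ j)

  K<H : ∀ i j → K i j < H
  K<H i j = A+B<H (i ⊖ j) (i ⊕ j) (m%n<n (i + m′ * j) m) (m%n<n (i + j) m)

  K-%ˡ : ∀ i j → K (i % m) j ≡ K i j
  K-%ˡ i j = cong₂ (λ x y → A x + B y) ([m%n+o]%n≡[m+o]%n i (m′ * j) m) ([m%n+o]%n≡[m+o]%n i j m)

  K-%ʳ : ∀ i j → K i (j % n) ≡ K i j
  K-%ʳ i j = cong₂ (λ x y → A x + B y) ([o+c*[j%n]]%m≡[o+c*j]%m i m′ j m∣2r) (begin
    (i + j % n) % m       ≡⟨ cong (λ x → (i + x) % m) (*-identityˡ (j % n)) ⟨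
    (i + 1 * (j % n)) % m ≡⟨ [o+c*[j%n]]%m≡[o+c*j]%m i 1 j m∣2r ⟩
    (i + 1 * j) % m       ≡⟨ cong (λ x → (i + x) % m) (*-identityˡ j) ⟩
    (i + j) % m           ∎)

  K-balanced : ∀ i j → K (i + 1) j + K (i + m′) j ≡ K i (j + 1) + K i (j + n′)
  K-balanced i j = begin
    K (i + 1) j + K (i + m′) j
      ≡⟨ cong₂ _+_ (cong₂ (λ x y → A x + B y) right⊖ right⊕) (cong₂ (λ x y → A x + B y) left⊖ left⊕) ⟩
    A (i ⊖ (j + n′)) + B (i ⊕ (j + 1)) + (A (i ⊖ (j + 1)) + B (i ⊕ (j + n′)))
      ≡⟨ exchange (A (i ⊖ (j + n′))) (B (i ⊕ (j + 1))) (A (i ⊖ (j + 1))) (B (i ⊕ (j + n′))) ⟩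
    K i (j + 1) + K i (j + n′) ∎
    where
    exchange : ∀ a b c d → a + b + (c + d) ≡ c + b + (a + d)
    exchange = solve-∀
    ring₁ : ∀ i j m′ n′ → i + 1 + m′ * j + suc n′ * suc m′ ≡ i + m′ * (j + n′) + (suc m′ + suc n′)
    ring₁ = solve-∀
    ring₂ : ∀ i j m′ → i + m′ + m′ * j ≡ i + m′ * (j + 1)
    ring₂ = solve-∀
    ring₃ : ∀ i j m′ n′ → i + m′ + j + suc n′ ≡ i + (j + n′) + 1 * suc m′
    ring₃ = solve-∀
    right⊖ : (i + 1) ⊖ j ≡ i ⊖ (j + n′)
    right⊖ = m+kn≡o+ln⇒m%n≡o%n (i + 1 + m′ * j) n (i + m′ * (j + n′)) (suc q) m (begin
      i + 1 + m′ * j + n * m      ≡⟨ ring₁ i j m′ n′ ⟩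
      i + m′ * (j + n′) + (m + n) ≡⟨ cong (λ x → i + m′ * (j + n′) + (m + x)) n≡qm ⟩
      i + m′ * (j + n′) + (m + q * m) ∎)
    right⊕ : (i + 1) ⊕ j ≡ i ⊕ (j + 1)
    right⊕ = cong (_% m) (xy∙z≈x∙zy i 1 j)
    left⊖ : (i + m′) ⊖ j ≡ i ⊖ (j + 1)
    left⊖ = cong (_% m) (ring₂ i j m′)
    left⊕ : (i + m′) ⊕ j ≡ i ⊕ (j + n′)
    left⊕ = m+kn≡o+ln⇒m%n≡o%n (i + m′ + j) q (i + (j + n′)) 1 m (begin
      i + m′ + j + q * m   ≡⟨ cong (i + m′ + j +_) n≡qm ⟨
      i + m′ + j + n       ≡⟨ ring₃ i j m′ n′ ⟩
      i + (j + n′) + 1 * m ∎)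

  -- Labels are 0-based (DistanceMagic adds 1); p is the parity of the row.
  rowLabel : ℕ → ℕ → ℕ
  rowLabel zero    k = H + k
  rowLabel (suc _) k = H ∸ suc k

  rowLabel<H+H : ∀ p k → k < H → rowLabel p k < H + H
  rowLabel<H+H zero    k k<H = +-monoʳ-< H k<H
  rowLabel<H+H (suc _) k k<H = <-≤-trans (∸-monoʳ-< z<s k<H) (m≤m+n H H)

  rowLabel-onto : ∀ y → y < H + H → ∃₂ λ p k → p < 2 × k < H × rowLabel p k ≡ y
  rowLabel-onto y y<H+H with H ≤? y
  ... | yes H≤y = 0 , y ∸ H , z<s , m<n+o⇒m∸n<o y H y<H+H , m+[n∸m]≡n H≤y
  ... | no  H≰y = 1 , H ∸ suc y , ≤-refl , ∸-monoʳ-< z<s y<H , mirror-involutive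
    where
    y<H : y < H
    y<H = ≰⇒> H≰y
    mirror-involutive : H ∸ suc (H ∸ suc y) ≡ y
    mirror-involutive = trans (cong (H ∸_) (sym (+-∸-assoc 1 y<H))) (m∸[m∸n]≡n (<⇒≤ y<H))

  mn≡H+H : m * n ≡ H + H
  mn≡H+H = double m r
    where
    double : ∀ m r → m * (2 * r) ≡ m * r + m * r
    double = solve-∀

  label : ℕ → ℕ → ℕ
  label i j = rowLabel (j % 2) (K i j)

  ℓ : Fin m × Fin n → Fin (m * n)
  ℓ (a , b) = fromℕ< (subst (label (toℕ a) (toℕ b) <_) (sym mn≡H+H)
                            (rowLabel<H+H (toℕ b % 2) (K (toℕ a) (toℕ b)) (K<H (toℕ a) (toℕ b))))

  toℕ-ℓ : ∀ a b → toℕ (ℓ (a , b)) ≡ label (toℕ a) (toℕ b)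
  toℕ-ℓ a b = toℕ-fromℕ< _

  L : Fin m × Fin n → ℕ
  L u = suc (toℕ (ℓ u))

  w : ℕ
  w = 2 + 4 * H

  rowLabel-balanced : ∀ {a b c d} → a + b ≡ c + d → c < H → d < H →
    suc (rowLabel 0 a) + suc (rowLabel 0 b) + suc (rowLabel 1 c) + suc (rowLabel 1 d) ≡ w
  rowLabel-balanced {a} {b} {c} {d} a+b≡c+d c<H d<H = +-cancelʳ-≡ (c + d) _ _ (begin
    suc (H + a) + suc (H + b) + suc (H ∸ suc c) + suc (H ∸ suc d) + (c + d)
      ≡⟨ regroup H a b (H ∸ suc c) (H ∸ suc d) c d ⟩
    2 + (H + H) + (a + b) + ((suc (H ∸ suc c) + c) + (suc (H ∸ suc d) + d))
      ≡⟨ cong₂ (λ x y → 2 + (H + H) + x + y) a+b≡c+d (cong₂ _+_ (mirror+ c c<H) (mirror+ d d<H)) ⟩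
    2 + (H + H) + (c + d) + (H + H)
      ≡⟨ regroup′ H (c + d) ⟩
    w + (c + d) ∎)
    where
    regroup : ∀ H a b x y c d → suc (H + a) + suc (H + b) + suc x + suc y + (c + d)
                              ≡ 2 + (H + H) + (a + b) + ((suc x + c) + (suc y + d))
    regroup = solve-∀
    regroup′ : ∀ H e → 2 + (H + H) + e + (H + H) ≡ 2 + 4 * H + e
    regroup′ = solve-∀
    mirror+ : ∀ k → k < H → suc (H ∸ suc k) + k ≡ H
    mirror+ k k<H = trans (sym (+-suc (H ∸ suc k) k)) (m∸n+n≡m k<H)

  2≤n′ : 2 ≤ n′
  2≤n′ = ≤-trans (s≤s 1≤r′) (≤-trans (m≤m+n r 0) (m≤n+m (r + 0) r′))

  [j+1]%n%2≡[j+1]%2 : ∀ j → (j + 1) % n % 2 ≡ (j + 1) % 2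
  [j+1]%n%2≡[j+1]%2 j = m∣n⇒o%n%m≡o%m 2 n (j + 1) (m∣m*n r)

  [j+n′]%n%2≡[j+1]%2 : ∀ j → (j + n′) % n % 2 ≡ (j + 1) % 2
  [j+n′]%n%2≡[j+1]%2 j = begin
    (j + n′) % n % 2     ≡⟨ m∣n⇒o%n%m≡o%m 2 n (j + n′) (m∣m*n r) ⟩
    (j + n′) % 2         ≡⟨ cong (_% 2) (odd-offset j r′) ⟩
    (j + 1 + r′ * 2) % 2 ≡⟨ [m+kn]%n≡m%n (j + 1) r′ 2 ⟩
    (j + 1) % 2          ∎
    where
    odd-offset : ∀ j r′ → j + (r′ + (suc r′ + 0)) ≡ j + 1 + r′ * 2
    odd-offset = solve-∀

  L-horizontal : ∀ c a b → L (rotate c a , b) ≡ suc (rowLabel (toℕ b % 2) (K (toℕ a + c) (toℕ b)))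
  L-horizontal c a b = cong suc (begin
    toℕ (ℓ (rotate c a , b))            ≡⟨ toℕ-ℓ (rotate c a) b ⟩
    rowLabel p (K (toℕ (rotate c a)) j) ≡⟨ cong (λ x → rowLabel p (K x j)) (toℕ-rotate c a) ⟩
    rowLabel p (K ((toℕ a + c) % m) j)  ≡⟨ cong (rowLabel p) (K-%ˡ (toℕ a + c) j) ⟩
    rowLabel p (K (toℕ a + c) j)        ∎)
    where
    j p : ℕ
    j = toℕ b
    p = j % 2

  L-vertical : ∀ c a b → (toℕ b + c) % n % 2 ≡ (toℕ b + 1) % 2 →
    L (a , rotate c b) ≡ suc (rowLabel ((toℕ b + 1) % 2) (K (toℕ a) (toℕ b + c)))
  L-vertical c a b parity = cong suc (begin
    toℕ (ℓ (a , rotate c b))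
      ≡⟨ toℕ-ℓ a (rotate c b) ⟩
    rowLabel (toℕ (rotate c b) % 2) (K i (toℕ (rotate c b)))
      ≡⟨ cong (λ y → rowLabel (y % 2) (K i y)) (toℕ-rotate c b) ⟩
    rowLabel ((j + c) % n % 2) (K i ((j + c) % n))
      ≡⟨ cong₂ rowLabel parity (K-%ʳ i (j + c)) ⟩
    rowLabel ((j + 1) % 2) (K i (j + c)) ∎)
    where
    i j : ℕ
    i = toℕ a
    j = toℕ b

  rows-balanced : ∀ i j →
    suc (rowLabel (j % 2) (K (i + 1) j)) + suc (rowLabel (j % 2) (K (i + m′) j)) +
    suc (rowLabel ((j + 1) % 2) (K i (j + 1))) + suc (rowLabel ((j + 1) % 2) (K i (j + n′))) ≡ w
  rows-balanced i j with %2-alternates j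
  ... | inj₁ (j-even , j+1-odd) rewrite j-even | j+1-odd =
    rowLabel-balanced (K-balanced i j) (K<H i (j + 1)) (K<H i (j + n′))
  ... | inj₂ (j-odd , j+1-even) rewrite j-odd | j+1-even =
    trans (swap-halves (suc (rowLabel 1 (K (i + 1) j))) (suc (rowLabel 1 (K (i + m′) j)))
                       (suc (rowLabel 0 (K i (j + 1)))) (suc (rowLabel 0 (K i (j + n′)))))
          (rowLabel-balanced (sym (K-balanced i j)) (K<H (i + 1) j) (K<H (i + m′) j))
    where
    swap-halves : ∀ x y z u → x + y + z + u ≡ z + u + x + y
    swap-halves = solve-∀

  weight-constant : ∀ v → weight (CmCn m n) L v ≡ w
  weight-constant (a , b) = begin
    weight (CmCn m n) L (a , b)
      ≡⟨ weight-CmCn 2≤m′ 2≤n′ L (a , b) ⟩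
    sum (map L (cycleNeighbours (a , b)))
      ≡⟨ sum-four (L (rotate 1 a , b)) (L (rotate m′ a , b)) (L (a , rotate 1 b)) (L (a , rotate n′ b)) ⟩
    L (rotate 1 a , b) + L (rotate m′ a , b) + L (a , rotate 1 b) + L (a , rotate n′ b)
      ≡⟨ cong₂ _+_ (cong₂ _+_ (cong₂ _+_ (L-horizontal 1 a b) (L-horizontal m′ a b))
                             (L-vertical 1 a b ([j+1]%n%2≡[j+1]%2 (toℕ b))))
                   (L-vertical n′ a b ([j+n′]%n%2≡[j+1]%2 (toℕ b))) ⟩
    _ ≡⟨ rows-balanced (toℕ a) (toℕ b) ⟩
    w ∎

  -- The vertex (s + j, j) has i ⊖ j = s and i ⊕ j = (s + 2j) mod m; shifting j by r
  -- keeps i ⊕ j (as m ∣ 2r) and flips the parity of the row (as r is odd).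
  K-onto : ∀ p k → p < 2 → k < H → ∃₂ λ i j → j < n × j % 2 ≡ p × K i j ≡ k
  K-onto p k p<2 k<H with A+B-onto k k<H
  ... | s , j , s<m , A+B≡k with parity-choice r-odd (j % r) p p<2
  ... | e , e<2 , parity≡p = s + j′ , j′ , x+er<2r e (m%n<n j r) e<2 , parity≡p , K≡k
    where
    j′ : ℕ
    j′ = j % r + e * r
    ⊖-at : (s + j′) ⊖ j′ ≡ s
    ⊖-at = begin
      (s + j′ + m′ * j′) % m ≡⟨ cong (_% m) (collect s j′ m′) ⟩
      (s + j′ * m) % m       ≡⟨ [m+kn]%n≡m%n s j′ m ⟩
      s % m                  ≡⟨ m<n⇒m%n≡m s<m ⟩
      s                      ∎
      where
      collect : ∀ s x m′ → s + x + m′ * x ≡ s + x * suc m′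
      collect = solve-∀
    ⊕-at : (s + j′) ⊕ j′ ≡ (s + 2 * j) % m
    ⊕-at = begin
      (s + j′ + j′) % m                      ≡⟨ cong (_% m) (+-assoc s j′ j′) ⟩
      (s + (j′ + j′)) % m                    ≡⟨ cong (λ x → (s + (j′ + x)) % m) (+-identityʳ j′) ⟨
      (s + 2 * (j % r + e * r)) % m          ≡⟨ [o+2[x+er]]%m≡[o+2[x+fr]]%m s (j % r) e (j / r) m∣2r ⟩
      (s + 2 * (j % r + j / r * r)) % m      ≡⟨ cong (λ x → (s + 2 * x) % m) (m≡m%n+[m/n]*n j r) ⟨
      (s + 2 * j) % m                        ∎
    K≡k : K (s + j′) j′ ≡ k
    K≡k = trans (cong₂ (λ x y → A x + B y) ⊖-at ⊕-at) A+B≡k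

  ℓ-surjective : StrictlySurjective _≡_ ℓ
  ℓ-surjective y with rowLabel-onto (toℕ y) (subst (toℕ y <_) mn≡H+H (toℕ<n y))
  ... | p , k , p<2 , k<H , rowLabel≡y with K-onto p k p<2 k<H
  ... | i , j , j<n , j%2≡p , Kij≡k = (i mod m , fromℕ< j<n) , toℕ-injective (begin
    toℕ (ℓ (i mod m , fromℕ< j<n))           ≡⟨ toℕ-ℓ (i mod m) (fromℕ< j<n) ⟩
    label (toℕ (i mod m)) (toℕ (fromℕ< j<n)) ≡⟨ cong₂ label (toℕ-mod i m) (toℕ-fromℕ< j<n) ⟩
    rowLabel (j % 2) (K (i % m) j)           ≡⟨ cong₂ rowLabel j%2≡p (trans (K-%ˡ i j) Kij≡k) ⟩
    rowLabel p k                             ≡⟨ rowLabel≡y ⟩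
    toℕ y                                    ∎)

  distanceMagic : DistanceMagic (CmCn m n)
  distanceMagic = ℓ , surjective⇒bijective ℓ-surjective , w , weight-constant

module OddDigits (u : ℕ) (1≤u : 1 ≤ u) where

  m : ℕ
  m = 1 + 2 * u

  2≤2u : 2 ≤ 2 * u
  2≤2u = *-monoʳ-≤ 2 1≤u

  m-odd : m % 2 ≡ 1
  m-odd = trans (cong (λ x → (1 + x) % 2) (*-comm 2 u)) ([m+kn]%n≡m%n 1 u 2)

  A B : ℕ → ℕ
  A s = s * m
  B t = t

  A+B<H : ∀ s t → s < m → t < m → A s + B t < m * m
  A+B<H s t s<m t<m = <-≤-trans (+-monoʳ-< (s * m) t<m) (≤-trans (≤-reflexive (+-comm (s * m) m)) (*-monoˡ-≤ m s<m))

  A+B-onto : ∀ k → k < m * m → ∃₂ λ s j → s < m × A s + B ((s + 2 * j) % m) ≡ k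
  A+B-onto k k<mm = s , j , m<n*o⇒m/o<n k<mm , (begin
    s * m + (s + 2 * j) % m ≡⟨ cong (s * m +_) s+2j≡t ⟩
    s * m + t               ≡⟨ +-comm (s * m) t ⟩
    t + s * m               ≡⟨ m≡m%n+[m/n]*n k m ⟨
    k                       ∎)
    where
    s t j : ℕ
    s = k / m
    t = k % m
    -- 2 (1 + u) ≡ 1 and 2u ≡ −1 (mod m), so this solves s + 2j ≡ t.
    j = (t + 2 * u * s) * (1 + u)
    halving : ∀ s t u → s + 2 * ((t + 2 * u * s) * (1 + u)) + 0 * (1 + 2 * u) ≡ t + (s + t + 2 * u * s) * (1 + 2 * u)
    halving = solve-∀
    s+2j≡t : (s + 2 * j) % m ≡ t
    s+2j≡t = trans (m+kn≡o+ln⇒m%n≡o%n (s + 2 * j) 0 t (s + t + 2 * u * s) m (halving s t u)) (m<n⇒m%n≡m (m%n<n k m))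

  distanceMagic : DistanceMagic (CmCn m (2 * m))
  distanceMagic = Construction.distanceMagic (2 * u) (2 * u) 2≤2u (<⇒≤ 2≤2u) m-odd (n∣m*n 2) A B A+B<H A+B-onto

module TwiceOddDigits (q : ℕ) (1≤q : 1 ≤ q) where

  r m rr : ℕ
  r  = 1 + 2 * q
  m  = 2 * r
  rr = r * r

  2≤2q : 2 ≤ 2 * q
  2≤2q = *-monoʳ-≤ 2 1≤q

  2≤m′ : 2 ≤ pred m
  2≤m′ = ≤-trans 2≤2q (m≤m+n (2 * q) (r + 0))

  r-odd : r % 2 ≡ 1
  r-odd = trans (cong (λ x → (1 + x) % 2) (*-comm 2 q)) ([m+kn]%n≡m%n 1 q 2)

  A B : ℕ → ℕ
  A s = s % 2 * rr + s / 2 * r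
  B t = t / 2

  halve : ∀ e a → e < 2 → (e + a * 2) / 2 ≡ a
  halve e a e<2 = trans (+-distrib-/-∣ʳ e (divides a refl)) (cong₂ _+_ (m<n⇒m/n≡0 e<2) (m*n/n≡m a 2))

  parity-of : ∀ e a → e < 2 → (e + a * 2) % 2 ≡ e
  parity-of e a e<2 = trans ([m+kn]%n≡m%n e a 2) (m<n⇒m%n≡m e<2)

  e+2a<m : ∀ e a → e < 2 → a < r → e + a * 2 < m
  e+2a<m e a e<2 a<r = <-≤-trans (+-monoˡ-< (a * 2) e<2) (≤-trans (*-monoˡ-≤ 2 a<r) (≤-reflexive (*-comm r 2)))

  half<r : ∀ s → s < m → s / 2 < r
  half<r s s<m = m<n*o⇒m/o<n (subst (s <_) (*-comm 2 r) s<m)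

  A+B<H : ∀ s t → s < m → t < m → A s + B t < m * r
  A+B<H s t s<m t<m = subst₂ _<_ (sym (+-assoc (s % 2 * rr) (s / 2 * r) (t / 2))) (two-squares r)
    (+-mono-≤-< (*-monoˡ-≤ rr (s≤s⁻¹ (m%n<n s 2))) lower-digits<rr)
    where
    two-squares : ∀ r → 1 * (r * r) + r * r ≡ 2 * r * r
    two-squares = solve-∀
    lower-digits<rr : s / 2 * r + t / 2 < rr
    lower-digits<rr = <-≤-trans (+-monoʳ-< (s / 2 * r) (half<r t t<m))
                                (≤-trans (≤-reflexive (+-comm (s / 2 * r) r)) (*-monoˡ-≤ r (half<r s s<m)))

  A+B-onto : ∀ k → k < m * r → ∃₂ λ s j → s < m × A s + B ((s + 2 * j) % m) ≡ k
  A+B-onto k k<H = e + a * 2 , b + 2 * q * a , e+2a<m e a e<2 a<r , (begin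
    A (e + a * 2) + B ((e + a * 2 + 2 * (b + 2 * q * a)) % m)
      ≡⟨ cong (λ x → A (e + a * 2) + B x) s+2j≡t ⟩
    A (e + a * 2) + B (e + b * 2)
      ≡⟨ cong₂ (λ x y → x * rr + y * r + B (e + b * 2)) (parity-of e a e<2) (halve e a e<2) ⟩
    e * rr + a * r + (e + b * 2) / 2   ≡⟨ cong (e * rr + a * r +_) (halve e b e<2) ⟩
    e * rr + a * r + b                 ≡⟨ digits e rr a r b ⟩
    (b + a * r) + e * rr               ≡⟨ cong (_+ e * rr) (m≡m%n+[m/n]*n (k % rr) r) ⟨
    k % rr + e * rr                    ≡⟨ m≡m%n+[m/n]*n k rr ⟨
    k                                  ∎)
    where
    -- k = e r² + a r + b in mixed radix; then s = e + 2a, t = e + 2b and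
    -- j = b + 2q a satisfy s + 2j = t + a m.
    e a b : ℕ
    e = k / rr
    a = k % rr / r
    b = k % rr % r
    e<2 : e < 2
    e<2 = m<n*o⇒m/o<n (subst (k <_) (*-assoc 2 r r) k<H)
    a<r : a < r
    a<r = m<n*o⇒m/o<n (m%n<n k rr)
    digits : ∀ e rr a r b → e * rr + a * r + b ≡ (b + a * r) + e * rr
    digits = solve-∀
    shift : ∀ e a b q → e + a * 2 + 2 * (b + 2 * q * a) + 0 ≡ e + b * 2 + a * (2 * (1 + 2 * q))
    shift = solve-∀
    s+2j≡t : (e + a * 2 + 2 * (b + 2 * q * a)) % m ≡ e + b * 2
    s+2j≡t = trans (m+kn≡o+ln⇒m%n≡o%n _ 0 _ a m (shift e a b q)) (m<n⇒m%n≡m (e+2a<m e b e<2 (m%n<n (k % rr) r)))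

  distanceMagic : DistanceMagic (CmCn m m)
  distanceMagic = Construction.distanceMagic (pred m) (2 * q) 2≤m′ (<⇒≤ 2≤2q) r-odd ∣-refl A B A+B<H A+B-onto

CmC2m-distanceMagic : ∀ {m} → 3 ≤ m → m % 2 ≡ 1 → DistanceMagic (CmCn m (2 * m))
CmC2m-distanceMagic {m} 3≤m m-odd =
  subst (λ k → DistanceMagic (CmCn k (2 * k))) (sym m≡1+2u) (OddDigits.distanceMagic u 1≤u)
  where
  u : ℕ
  u = m / 2
  m≡1+2u : m ≡ 1 + 2 * u
  m≡1+2u = trans (m≡m%n+[m/n]*n m 2) (cong₂ _+_ m-odd (*-comm u 2))
  1≤u : 1 ≤ u
  1≤u = *-cancelˡ-≤ 2 (s≤s⁻¹ (subst (3 ≤_) m≡1+2u 3≤m))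

CmCm-distanceMagic : ∀ {m} → 3 ≤ m → m % 4 ≡ 2 → DistanceMagic (CmCn m m)
CmCm-distanceMagic {m} 3≤m m%4≡2 =
  subst (λ k → DistanceMagic (CmCn k k)) (sym m≡2[1+2q]) (TwiceOddDigits.distanceMagic q 1≤q)
  where
  q : ℕ
  q = m / 4
  m≡2[1+2q] : m ≡ 2 * (1 + 2 * q)
  m≡2[1+2q] = trans (m≡m%n+[m/n]*n m 4) (trans (cong (_+ q * 4) m%4≡2) (regroup q))
    where
    regroup : ∀ q → 2 + q * 4 ≡ 2 * (1 + 2 * q)
    regroup = solve-∀
  1≤q : 1 ≤ q
  1≤q = n≢0⇒n>0 q≢0
    where
    q≢0 : q ≢ 0
    q≢0 q≡0 = contradiction (subst (3 ≤_) m≡2 3≤m) λ { (s≤s (s≤s ())) }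
      where
      m≡2 : m ≡ 2
      m≡2 = trans m≡2[1+2q] (cong (λ x → 2 * (1 + 2 * x)) q≡0)

theorem1p1 : (m n : ℕ) → 3 ≤ m → m ≤ n →
    DistanceMagic (CmCn m n) ⇔ ((n ≡ 2 * m × m % 2 ≡ 1) ⊎ (n ≡ m × m % 4 ≡ 2))
theorem1p1 (suc m′) (suc n′) (s≤s 2≤m′) m≤n = mk⇔ (distanceMagic⇒conditions m′ n′ 2≤m′ m≤n) sufficient
  where
  sufficient : (suc n′ ≡ 2 * suc m′ × suc m′ % 2 ≡ 1) ⊎ (suc n′ ≡ suc m′ × suc m′ % 4 ≡ 2) →
               DistanceMagic (CmCn (suc m′) (suc n′))
  sufficient (inj₁ (n≡2m , m-odd)) =
    subst (DistanceMagic ∘ CmCn (suc m′)) (sym n≡2m) (CmC2m-distanceMagic (s≤s 2≤m′) m-odd)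
  sufficient (inj₂ (n≡m , m%4≡2)) =
    subst (DistanceMagic ∘ CmCn (suc m′)) (sym n≡m) (CmCm-distanceMagic (s≤s 2≤m′) m%4≡2)
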